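{- There are constants $c,\beta\ge 0$ such that for all sufficiently large $n$ and every integer $k>\frac{4}{7}n+c$, the pair $(n,k)$ is $(2,\beta)$-approx good.
   Context: All graphs are finite, undirected and unweighted. A $k$-spanner of $G=(V,E)$ is a subgraph $H=(V,E')$, $E'\subseteq E$, with $\mathsf{dist}_H(u,v)\le k\cdot\mathsf{dist}_G(u,v)$ for all $u,v\in V$, where $\mathsf{dist}$ is shortest-path length. The girth of a graph is the length of its shortest cycle ($\infty$ if acyclic). For constants $\alpha>1$, $\beta\ge 0$, the pair $(n,k)$ is $(\alpha,\beta)$-approx good if every connected $n$-vertex graph $G$ has a $k$-spanner $H=(V,E_H)$ of girth at least $k+2$ with $|E_H|-n\le \alpha(\mathsf{OPT}-n)+\beta$, where $\mathsf{OPT}$ is the number of edges of a minimum (fewest-edge) $k$-spanner of $G$. -}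

module Defs where

open import Data.Nat using (ℕ; zero; suc; _+_; _*_; _≤_; _<_; _<ᵇ_)
open import Data.Bool using (Bool; true; false; _∧_; if_then_else_)
open import Data.Fin using (Fin; toℕ; inject₁; fromℕ)
import Data.Fin as Fin
open import Data.List using (List; map)
open import Data.Nat.ListAction using (sum)
open import Data.List using () renaming (allFin to allFinL)
open import Data.Product using (Σ; _×_)
open import Relation.Binary.PropositionalEquality using (_≡_)
open import Function.Definitions using (Injective)

record Graph (n : ℕ) : Set where
  field
    adj    : Fin n → Fin n → Bool
    sym    : ∀ i j → adj i j ≡ adj j i
    irrefl : ∀ i → adj i i ≡ false
open Graph public

Adj : ∀ {n} → Graph n → Fin n → Fin n → Set
Adj G i j = adj G i j ≡ true

indicator : Bool → ℕ
indicator b = if b then 1 else 0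

numEdges : ∀ {n} → Graph n → ℕ
numEdges {n} G =
  sum (map (λ i → sum (map (λ j → indicator ((toℕ i <ᵇ toℕ j) ∧ adj G i j))
                           (allFinL n)))
           (allFinL n))

data Walk {n : ℕ} (G : Graph n) : Fin n → Fin n → ℕ → Set where
  here : ∀ {u} → Walk G u u 0
  step : ∀ {u w v d} → Adj G u w → Walk G w v d → Walk G u v (suc d)

Connected : ∀ {n} → Graph n → Set
Connected {n} G = ∀ (u v : Fin n) → Σ ℕ (λ d → Walk G u v d)

Subgraph : ∀ {n} → Graph n → Graph n → Set
Subgraph {n} H G = ∀ (i j : Fin n) → Adj H i j → Adj G i j

-- dist_H(u,v) ≤ k · dist_G(u,v) for all u v, written out via walks:
-- every u–v walk of length d in G is matched by a u–v walk in H of length ≤ k·d.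
-- (If u,v are disconnected in G, dist_G = ∞ and the condition is vacuous.)
StretchAtMost : ∀ {n} → ℕ → Graph n → Graph n → Set
StretchAtMost {n} k H G =
  ∀ (u v : Fin n) (d : ℕ) → Walk G u v d →
    Σ ℕ (λ d' → Walk H u v d' × (d' ≤ k * d))

IsSpanner : ∀ {n} → ℕ → Graph n → Graph n → Set
IsSpanner k H G = Subgraph H G × StretchAtMost k H G

-- A cycle of length m+3: distinct vertices v_0 … v_{m+2}, consecutive ones adjacent,
-- and v_{m+2} adjacent to v_0.
record Cycle {n : ℕ} (G : Graph n) (m : ℕ) : Set where
  field
    vtx   : Fin (suc (suc (suc m))) → Fin n
    inj   : Injective _≡_ _≡_ vtx
    cons  : ∀ (i : Fin (suc (suc m))) → Adj G (vtx (inject₁ i)) (vtx (Fin.suc i))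
    close : Adj G (vtx (fromℕ (suc (suc m)))) (vtx Fin.zero)

GirthAtLeast : ∀ {n} → ℕ → Graph n → Set
GirthAtLeast g G = ∀ (m : ℕ) → Cycle G m → g ≤ suc (suc (suc m))

-- (n,k) is (α,β)-approx good, for natural α, β.
-- |E_H| - n ≤ α (OPT - n) + β  is rearranged (over ℤ) to  |E_H| + α n ≤ α OPT + n + β,
-- and "≤ α OPT + …" is expressed as "≤ α |E_{H'}| + … for every k-spanner H'"
-- (OPT is the minimum of |E_{H'}| over k-spanners H').
ApproxGood : ℕ → ℕ → ℕ → ℕ → Set
ApproxGood α β n k =
  ∀ (G : Graph n) → Connected G →
    Σ (Graph n) (λ H →
      IsSpanner k H G × GirthAtLeast (k + 2) H ×
      (∀ (H' : Graph n) → IsSpanner k H' G →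
         numEdges H + α * n ≤ α * numEdges H' + n + β))

-- The greedy k-spanner, which keeps an edge of G whenever its ends are more than k apart in
-- the spanner built so far, is a k-spanner.  Listing its edges newest first, every nonempty
-- even edge set (a nonzero element of the cycle space over GF(2)) has at least k + 2 edges:
-- its newest edge closes a walk through its other edges, which the greedy rule forces to be
-- longer than k.  In particular the girth is at least k + 2.  If three edges had closed
-- cycles when they were added, these cycles would have distinct newest edges and span seven
-- nonempty even sets, using each of the at most n + 2 edges involved at most four times; so
-- 7 (k + 2) ≤ 4 (n + 2), contradicting 7 k > 4 n.  Hence the spanner has at most n + 1 edges,
-- while any k-spanner of a connected graph is connected and has at least n - 1 edges, which
-- gives the bound with α = 2 and β = 3.

module Submission where

open import Algebra.Bundles using (CommutativeRing)
open import Data.Bool using (Bool; true; false; _∧_; _xor_; if_then_else_)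
import Data.Bool.Properties as Bool
open import Data.Bool.Properties
  using (T-≡; ∧-zeroʳ; if-eta; xor-same; xor-comm; xor-assoc; xor-identityʳ; ∧-distribʳ-xor; xor-∧-commutativeRing)
open import Algebra.Properties.CommutativeSemigroup (CommutativeRing.+-commutativeSemigroup xor-∧-commutativeRing)
  using () renaming (interchange to xor-interchange; x∙yz≈y∙xz to xor-left-comm)
open import Data.Bool.Solver using (module xor-∧-Solver)
open xor-∧-Solver using (_:+_; _:=_; con) renaming (solve to solve-xor)
open import Data.Empty using (⊥-elim)
open import Data.Fin as Fin using (Fin; toℕ; inject₁; fromℕ)
open import Data.Fin.Properties using (_≟_; any?; punchInᵢ≢i; toℕ<n; toℕ-injective)
open import Data.List using (List; []; _∷_; _++_; length; map; filter; tabulate; allFin; cartesianProduct)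
open import Data.List.Membership.Propositional using (_∈_)
open import Data.List.Membership.Propositional.Properties using (∈-cartesianProduct⁺; ∈-allFin; ∈-filter⁺)
open import Data.List.Properties using (map-∘; map-++)
open import Data.List.Relation.Unary.All as All using (All; []; _∷_)
open import Data.List.Relation.Unary.All.Properties using (─⁺)
open import Data.List.Relation.Unary.Any as Any using (Any; _─_)
open import Data.List.Relation.Unary.Any.Properties using (lookup-result)
open import Data.Nat using (ℕ; zero; suc; _+_; _*_; _≤_; _<_; _<ᵇ_; z≤n; s≤s; s≤s⁻¹)
open import Data.Nat.ListAction using (sum)
open import Data.Nat.ListAction.Properties using (sum-++)
open import Data.Nat.Properties
  using ( _≤?_; <-cmp; <⇒<ᵇ; ≤-refl; ≤-reflexive; ≤-trans; ≤-antisym; <⇒≤; ≤-<-trans; <-trans; ≰⇒>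
        ; m≤m+n; m≤n+m; +-mono-≤; +-monoˡ-≤; +-monoʳ-≤; *-monoˡ-≤; *-monoʳ-≤; +-cancelˡ-≤
        ; suc-injective; +-comm; +-suc; *-suc; +-identityʳ
        ; +-0-commutativeMonoid; +-commutativeSemigroup; module ≤-Reasoning)
open import Algebra.Properties.CommutativeSemigroup +-commutativeSemigroup
  using () renaming (interchange to +-interchange)
open import Algebra.Properties.CommutativeMonoid.Sum +-0-commutativeMonoid
  using (sum-remove; sum-cong-≗; sum-replicate-zero; ∑-distrib-+) renaming (sum to ∑)
open import Data.Nat.Tactic.RingSolver using (solve-∀)
open import Data.Product using (Σ; ∃; ∃₂; _×_; _,_; proj₁; proj₂)
import Data.Product as Product
open import Data.Product.Properties using (≡-dec)
open import Data.Sum using (_⊎_; inj₁; inj₂)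
import Data.Sum as Sum
open import Data.Vec.Functional using (removeAt)
open import Function.Base using (id; _∘_; case_of_)
open import Function.Bundles using (mk⇔; Equivalence)
open import Relation.Binary using (tri<; tri≈; tri>)
open import Relation.Binary.PropositionalEquality
open import Relation.Nullary using (¬_; Dec; yes; no; does; contradiction)
open import Relation.Nullary.Decidable using (T?; dec-true; dec-false; does-⇔; map′; ¬?; _×-dec_; _⊎-dec_)

open import Defs hiding (sym)


private
  variable
    n : ℕ

Edge : ℕ → Set
Edge n = Fin n × Fin n

allPairs : ∀ n → List (Edge n)
allPairs n = cartesianProduct (allFin n) (allFin n)

IsEdgeOf : Graph n → Edge n → Set
IsEdgeOf H e = Adj H (proj₁ e) (proj₂ e)

Adj-sym : ∀ {H : Graph n} {u v} → Adj H u v → Adj H v u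
Adj-sym {H = H} {u} {v} a = trans (Graph.sym H v u) a

Adj⇒≢ : ∀ {H : Graph n} {u v} → Adj H u v → u ≢ v
Adj⇒≢ {H = H} {u} a refl with () ← trans (sym a) (irrefl H u)

walk-++ : ∀ {H : Graph n} {u v w d d'} → Walk H u v d → Walk H v w d' → Walk H u w (d + d')
walk-++ here W' = W'
walk-++ (step a W) W' = step a (walk-++ W W')

walk-map : ∀ {G H : Graph n} → Subgraph G H → ∀ {u v d} → Walk G u v d → Walk H u v d
walk-map G⊆H here = here
walk-map G⊆H (step a W) = step (G⊆H _ _ a) (walk-map G⊆H W)

ShortWalk : Graph n → ℕ → Fin n → Fin n → Set
ShortWalk H k u v = ∃ λ d → Walk H u v d × d ≤ k

shortWalk? : (H : Graph n) (k : ℕ) (u v : Fin n) → Dec (ShortWalk H k u v)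
shortWalk? H k u v with u ≟ v
... | yes refl = yes (0 , here , z≤n)
shortWalk? H zero u v | no u≢v = no λ { (0 , here , _) → u≢v refl }
shortWalk? H (suc k) u v | no u≢v =
  map′ extend shorten (any? λ w → (adj H u w Bool.≟ true) ×-dec shortWalk? H k w v)
  where
  extend : (∃ λ w → Adj H u w × ShortWalk H k w v) → ShortWalk H (suc k) u v
  extend (w , a , d , W , d≤k) = suc d , step a W , s≤s d≤k
  shorten : ShortWalk H (suc k) u v → ∃ λ w → Adj H u w × ShortWalk H k w v
  shorten (0 , here , _) = ⊥-elim (u≢v refl)
  shorten (suc d , step a W , s≤s d≤k) = _ , a , d , W , d≤k

shortWalk-weaken : ∀ {H : Graph n} {k k′ x y} → ShortWalk H k x y → k ≤ k′ → ShortWalk H k′ x y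
shortWalk-weaken (d , W , d≤k) k≤k′ = d , W , ≤-trans d≤k k≤k′

shortWalk-step : ∀ {H : Graph n} {k x y z} → Adj H x y → ShortWalk H k y z → ShortWalk H (suc k) x z
shortWalk-step a (d , W , d≤k) = suc d , step a W , s≤s d≤k

Joins : Fin n → Fin n → Edge n → Set
Joins u v e = e ≡ (u , v) ⊎ e ≡ (v , u)

Link : List (Edge n) → Fin n → Fin n → Set
Link L u v = u ≢ v × Any (Joins u v) L

opaque
  link? : ∀ {n} (L : List (Edge n)) (u v : Fin n) → Dec (Link L u v)
  link? {n} L u v = ¬? (u ≟ v) ×-dec Any.any? joins? L
    where
    _≟ₑ_ : (e e′ : Edge n) → Dec (e ≡ e′)
    _≟ₑ_ = ≡-dec _≟_ _≟_
    joins? : ∀ e → Dec (Joins u v e)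
    joins? e = (e ≟ₑ (u , v)) ⊎-dec (e ≟ₑ (v , u))

Link-sym : ∀ {L : List (Edge n)} {u v} → Link L u v → Link L v u
Link-sym (u≢v , p) = (λ v≡u → u≢v (sym v≡u)) , Any.map Sum.swap p

graphOf : List (Edge n) → Graph n
adj (graphOf L) u v = does (link? L u v)
Graph.sym (graphOf L) u v = does-⇔ (mk⇔ Link-sym Link-sym) (link? L u v) (link? L v u)
irrefl (graphOf L) u = dec-false (link? L u u) λ (u≢u , _) → u≢u refl

Link⇒Adj : ∀ {L : List (Edge n)} {u v} → Link L u v → Adj (graphOf L) u v
Link⇒Adj {L = L} {u} {v} = dec-true (link? L u v)

Adj⇒Link : ∀ {L : List (Edge n)} {u v} → Adj (graphOf L) u v → Link L u v
Adj⇒Link {L = L} {u} {v} = does≡true⇒ (link? L u v)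
  where
  does≡true⇒ : ∀ {A : Set} (a? : Dec A) → does a? ≡ true → A
  does≡true⇒ (yes a) _ = a

Joins⇒Adj : ∀ {H : Graph n} {u v e} → Joins u v e → IsEdgeOf H e → Adj H u v
Joins⇒Adj (inj₁ refl) a = a
Joins⇒Adj {H = H} (inj₂ refl) a = Adj-sym {H = H} a

graphOf-∷ : ∀ e (R : List (Edge n)) → Subgraph (graphOf R) (graphOf (e ∷ R))
graphOf-∷ e R u v a = let (u≢v , p) = Adj⇒Link {L = R} a in Link⇒Adj {L = e ∷ R} (u≢v , Any.there p)

-- Boundaries over GF(2)

_==_ : Fin n → Fin n → Bool
u == v = does (u ≟ v)

ends : Edge n → Fin n → Bool
ends e w = (w == proj₁ e) xor (w == proj₂ e)

∂ : List (Edge n) → Fin n → Bool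
∂ [] w = false
∂ (e ∷ D) w = ends e w xor ∂ D w

ends-Joins : ∀ {u v} {e : Edge n} → Joins u v e → ∀ w → ends e w ≡ ends (u , v) w
ends-Joins (inj₁ refl) w = refl
ends-Joins {u = u} {v} (inj₂ refl) w = xor-comm (w == v) (w == u)

ends-left : ∀ {u v : Fin n} → u ≢ v → ends (u , v) u ≡ true
ends-left {u = u} {v} u≢v rewrite dec-true (u ≟ u) refl | dec-false (u ≟ v) u≢v = refl

ends-right : ∀ {u v : Fin n} → u ≢ v → ends (u , v) v ≡ true
ends-right {u = u} {v} u≢v = trans (xor-comm (v == u) (v == v)) (ends-left (λ v≡u → u≢v (sym v≡u)))

ends-off : ∀ {u v z : Fin n} → z ≢ u → z ≢ v → ends (u , v) z ≡ false
ends-off {u = u} {v} {z} z≢u z≢v rewrite dec-false (z ≟ u) z≢u | dec-false (z ≟ v) z≢v = refl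

∂-true⇒incident : ∀ (D : List (Edge n)) {w} → ∂ D w ≡ true → Any (λ e → ends e w ≡ true) D
∂-true⇒incident (e ∷ D) {w} odd with ends e w in eq
... | true = Any.here eq
... | false = Any.there (∂-true⇒incident D odd)

∂-─ : ∀ {P : Edge n → Set} {D : List (Edge n)} (p : Any P D) w →
      ∂ D w ≡ ends (Any.lookup p) w xor ∂ (D ─ p) w
∂-─ (Any.here _) w = refl
∂-─ {D = e ∷ D} (Any.there p) w =
  trans (cong (ends e w xor_) (∂-─ p w)) (xor-left-comm (ends e w) (ends (Any.lookup p) w) (∂ (D ─ p) w))

length-─ : ∀ {A : Set} {P : A → Set} {xs : List A} (p : Any P xs) → length xs ≡ suc (length (xs ─ p))
length-─ (Any.here _) = refl
length-─ (Any.there p) = cong suc (length-─ p)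

other-end : ∀ {H : Graph n} {e x} → IsEdgeOf H e → ends e x ≡ true →
           ∃ λ y → Adj H x y × (∀ w → ends e w ≡ ends (x , y) w)
other-end {H = H} {e = a , b} {x} ab odd with x ≟ a | x ≟ b
... | yes refl | _ = b , ab , λ w → refl
... | no _ | yes refl = a , Adj-sym {H = H} ab , λ w → xor-comm (w == a) (w == x)
... | no _ | no _ with () ← odd

xor-cancel : ∀ a b c → (a xor b) xor (a xor c) ≡ b xor c
xor-cancel a b c = trans (xor-interchange a b a c) (cong (_xor (b xor c)) (xor-same a))

xor-move : ∀ {a c} b → a ≡ b xor c → c ≡ b xor a
xor-move {c = c} b refl = sym (trans (sym (xor-assoc b b c)) (cong (_xor c) (xor-same b)))

-- Leave x along an edge at x and recurse from its other end on the remaining edges.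
∂≡ends⇒shortWalk : ∀ {H : Graph n} (D : List (Edge n)) → All (IsEdgeOf H) D →
                   ∀ {x y} → (∀ w → ∂ D w ≡ ends (x , y) w) → ShortWalk H (length D) x y
∂≡ends⇒shortWalk {H = H} D = go (length D) D refl
  where
  go : ∀ m D → length D ≡ m → All (IsEdgeOf H) D →
       ∀ {x y} → (∀ w → ∂ D w ≡ ends (x , y) w) → ShortWalk H m x y
  go m D len edges {x} {y} bd with x ≟ y
  ... | yes refl = 0 , here , z≤n
  go zero [] _ _ {x} bd | no x≢y with () ← trans (bd x) (ends-left x≢y)
  go (suc m) D len edges {x} {y} bd | no x≢y =
    shortWalk-step {H = H} xz (go m (D ─ p) (suc-injective (trans (sym (length-─ p)) len)) (─⁺ p edges) bd′)
    where
    open ≡-Reasoning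
    p : Any (λ e → ends e x ≡ true) D
    p = ∂-true⇒incident D (trans (bd x) (ends-left x≢y))
    e = Any.lookup p
    e-at-x : IsEdgeOf H e × ends e x ≡ true
    e-at-x = All.lookupAny edges p
    other : ∃ λ z → Adj H x z × (∀ w → ends e w ≡ ends (x , z) w)
    other = other-end {H = H} {e = e} {x = x} (proj₁ e-at-x) (proj₂ e-at-x)
    z = proj₁ other
    xz = proj₁ (proj₂ other)
    e≗xz = proj₂ (proj₂ other)
    bd′ : ∀ w → ∂ (D ─ p) w ≡ ends (z , y) w
    bd′ w = begin
      ∂ (D ─ p) w                       ≡⟨ xor-move (ends e w) (∂-─ p w) ⟩
      ends e w xor ∂ D w                ≡⟨ cong₂ _xor_ (e≗xz w) (bd w) ⟩
      ends (x , z) w xor ends (x , y) w ≡⟨ xor-cancel (w == x) (w == z) (w == y) ⟩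
      ends (z , y) w                    ∎

-- Edge subsets, as bit masks indexed by position in the list (the head has index 0)

Mask : Set
Mask = ℕ → Bool

∅ : Mask
∅ _ = false

_◂_ : Bool → Mask → Mask
(b ◂ χ) zero = b
(b ◂ χ) (suc i) = χ i

infixl 6 _⊕_

_⊕_ : Mask → Mask → Mask
(χ ⊕ ψ) i = χ i xor ψ i

select : ∀ {A : Set} → List A → Mask → List A
select [] χ = []
select (x ∷ xs) χ = if χ 0 then x ∷ select xs (χ ∘ suc) else select xs (χ ∘ suc)

size : ∀ {A : Set} → List A → Mask → ℕ
size xs χ = length (select xs χ)

Even : List (Edge n) → Mask → Set
Even L χ = ∀ w → ∂ (select L χ) w ≡ false

select-∅ : ∀ {A : Set} (xs : List A) → select xs ∅ ≡ []
select-∅ [] = refl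
select-∅ (x ∷ xs) = select-∅ xs

select-All : ∀ {A : Set} {P : A → Set} {xs} χ → All P xs → All P (select xs χ)
select-All χ [] = []
select-All χ (px ∷ pxs) with χ 0
... | true = px ∷ select-All (χ ∘ suc) pxs
... | false = select-All (χ ∘ suc) pxs

∂-select-∷ : ∀ e (R : List (Edge n)) χ w →
             ∂ (select (e ∷ R) χ) w ≡ (χ 0 ∧ ends e w) xor ∂ (select R (χ ∘ suc)) w
∂-select-∷ e R χ w with χ 0
... | true = refl
... | false = refl

∂-select-⊕ : ∀ (L : List (Edge n)) χ ψ w →
             ∂ (select L (χ ⊕ ψ)) w ≡ ∂ (select L χ) w xor ∂ (select L ψ) w
∂-select-⊕ [] χ ψ w = refl
∂-select-⊕ (e ∷ R) χ ψ w = begin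
  ∂ (select (e ∷ R) (χ ⊕ ψ)) w
    ≡⟨ ∂-select-∷ e R (χ ⊕ ψ) w ⟩
  ((χ 0 xor ψ 0) ∧ ε) xor ∂ (select R (χ′ ⊕ ψ′)) w
    ≡⟨ cong₂ _xor_ (∧-distribʳ-xor ε (χ 0) (ψ 0)) (∂-select-⊕ R χ′ ψ′ w) ⟩
  ((χ 0 ∧ ε) xor (ψ 0 ∧ ε)) xor (A xor B)
    ≡⟨ xor-interchange (χ 0 ∧ ε) (ψ 0 ∧ ε) A B ⟩
  ((χ 0 ∧ ε) xor A) xor ((ψ 0 ∧ ε) xor B)
    ≡⟨ cong₂ _xor_ (∂-select-∷ e R χ w) (∂-select-∷ e R ψ w) ⟨
  ∂ (select (e ∷ R) χ) w xor ∂ (select (e ∷ R) ψ) w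
    ∎
  where
  open ≡-Reasoning
  ε = ends e w
  χ′ = χ ∘ suc
  ψ′ = ψ ∘ suc
  A = ∂ (select R χ′) w
  B = ∂ (select R ψ′) w

Even-⊕ : ∀ {L : List (Edge n)} {χ ψ} → Even L χ → Even L ψ → Even L (χ ⊕ ψ)
Even-⊕ {L = L} {χ} {ψ} evχ evψ w = trans (∂-select-⊕ L χ ψ w) (cong₂ _xor_ (evχ w) (evψ w))

size-∷ : ∀ {A : Set} x (xs : List A) χ → size (x ∷ xs) χ ≡ indicator (χ 0) + size xs (χ ∘ suc)
size-∷ x xs χ with χ 0
... | true = refl
... | false = refl

indicator-xor : ∀ a b → indicator (a xor b) ≤ indicator a + indicator b
indicator-xor false b = ≤-refl
indicator-xor true false = ≤-refl
indicator-xor true true = z≤n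

size-⊕ : ∀ {A : Set} (L : List A) χ ψ → size L (χ ⊕ ψ) ≤ size L χ + size L ψ
size-⊕ [] χ ψ = z≤n
size-⊕ (x ∷ xs) χ ψ = begin
  size (x ∷ xs) (χ ⊕ ψ)
    ≡⟨ size-∷ x xs (χ ⊕ ψ) ⟩
  indicator (χ 0 xor ψ 0) + size xs (χ′ ⊕ ψ′)
    ≤⟨ +-mono-≤ (indicator-xor (χ 0) (ψ 0)) (size-⊕ xs χ′ ψ′) ⟩
  (indicator (χ 0) + indicator (ψ 0)) + (size xs χ′ + size xs ψ′)
    ≡⟨ +-interchange (indicator (χ 0)) _ _ _ ⟩
  (indicator (χ 0) + size xs χ′) + (indicator (ψ 0) + size xs ψ′)
    ≡⟨ cong₂ _+_ (size-∷ x xs χ) (size-∷ x xs ψ) ⟨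
  size (x ∷ xs) χ + size (x ∷ xs) ψ
    ∎
  where
  open ≤-Reasoning
  χ′ = χ ∘ suc
  ψ′ = ψ ∘ suc

bit⇒nonempty : ∀ {A : Set} (L : List A) {χ} i → i < length L → χ i ≡ true → 1 ≤ size L χ
bit⇒nonempty (x ∷ xs) {χ} zero _ bit rewrite bit = s≤s z≤n
bit⇒nonempty (x ∷ xs) {χ} (suc i) (s≤s i<n) bit =
  ≤-trans (bit⇒nonempty xs i i<n bit) (≤-trans (m≤n+m _ (indicator (χ 0))) (≤-reflexive (sym (size-∷ x xs χ))))

only : ∀ {A : Set} {P : A → Set} {xs} → Any P xs → Mask
only (Any.here _) = true ◂ ∅
only (Any.there p) = false ◂ only p

pos : ∀ {A : Set} {P : A → Set} {xs} → Any P xs → ℕ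
pos p = toℕ (Any.index p)

select-only : ∀ {A : Set} {P : A → Set} {xs : List A} (p : Any P xs) → select xs (only p) ≡ Any.lookup p ∷ []
select-only {xs = x ∷ xs} (Any.here _) = cong (x ∷_) (select-∅ xs)
select-only (Any.there p) = select-only p

only-pos : ∀ {A : Set} {P : A → Set} {xs} (p : Any P xs) → only p (pos p) ≡ true
only-pos (Any.here _) = refl
only-pos (Any.there p) = only-pos p

only-pos⇒lookup : ∀ {A : Set} {P Q : A → Set} {xs} (p : Any P xs) (q : Any Q xs) →
                  only p (pos q) ≡ true → Any.lookup p ≡ Any.lookup q
only-pos⇒lookup (Any.here _) (Any.here _) _ = refl
only-pos⇒lookup (Any.there p) (Any.there q) eq = only-pos⇒lookup p q eq

-- Edge lists are kept newest first, so R lists the edges older than (x , y).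

data Greedy {n} (k : ℕ) : List (Edge n) → Set where
  [] : Greedy k []
  _∷_ : ∀ {x y R} → ¬ ShortWalk (graphOf R) k x y → Greedy k R → Greedy k ((x , y) ∷ R)

greedy-edges : ∀ {k} {L : List (Edge n)} → Greedy k L → All (IsEdgeOf (graphOf L)) L
greedy-edges [] = []
greedy-edges {L = (x , y) ∷ R} (far ∷ g) =
  Link⇒Adj {L = (x , y) ∷ R} (x≢y , Any.here (inj₁ refl)) ∷ All.map (graphOf-∷ (x , y) R _ _) (greedy-edges g)
  where
  x≢y : x ≢ y
  x≢y refl = far (0 , here , z≤n)

-- The newest edge of the subset closes a walk through its older edges, which the greedy
-- rule forces to be longer than k.
greedy-even-size : ∀ {k} {L : List (Edge n)} {χ} → Greedy k L → Even L χ → 1 ≤ size L χ → k + 2 ≤ size L χ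
greedy-even-size {k = k} {L = (x , y) ∷ R} {χ} (far ∷ g) ev nonempty with χ 0
... | false = greedy-even-size g ev nonempty
... | true = subst (_≤ suc (length D)) (+-comm 2 k) (s≤s (≰⇒> short⇒⊥))
  where
  D = select R (χ ∘ suc)
  bd : ∀ w → ∂ D w ≡ ends (x , y) w
  bd w = trans (xor-move (ends (x , y) w) (sym (ev w))) (xor-identityʳ (ends (x , y) w))
  short⇒⊥ : ¬ length D ≤ k
  short⇒⊥ D≤k = far (shortWalk-weaken (∂≡ends⇒shortWalk D (select-All (χ ∘ suc) (greedy-edges g)) bd) D≤k)

Apart : Edge n → Edge n → Set
Apart e e′ = ∃ λ z → ends e z ≢ ends e′ z

apart-at : ∀ {e e′ : Edge n} z → ends e′ z ≡ false → ends e z ≡ true → Apart e′ e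
apart-at z off on = z , λ eq → case trans (sym off) (trans eq on) of λ ()

liftMask : ∀ (L : List (Edge n)) (D : List (Edge n)) → All (IsEdgeOf (graphOf L)) D → Mask
liftMask L [] [] = ∅
liftMask L (e ∷ D) (a ∷ as) = only (proj₂ (Adj⇒Link {L = L} a)) ⊕ liftMask L D as

∂-liftMask : ∀ (L : List (Edge n)) D (as : All (IsEdgeOf (graphOf L)) D) w →
             ∂ (select L (liftMask L D as)) w ≡ ∂ D w
∂-liftMask L [] [] w = cong (λ xs → ∂ xs w) (select-∅ L)
∂-liftMask L (e ∷ D) (a ∷ as) w = begin
  ∂ (select L (only p ⊕ liftMask L D as)) w
    ≡⟨ ∂-select-⊕ L (only p) (liftMask L D as) w ⟩
  ∂ (select L (only p)) w xor ∂ (select L (liftMask L D as)) w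
    ≡⟨ cong₂ _xor_ (cong (λ xs → ∂ xs w) (select-only p)) (∂-liftMask L D as w) ⟩
  (ends (Any.lookup p) w xor false) xor ∂ D w
    ≡⟨ cong (_xor ∂ D w) (trans (xor-identityʳ _) (ends-Joins (lookup-result p) w)) ⟩
  ends e w xor ∂ D w
    ∎
  where
  open ≡-Reasoning
  p = proj₂ (Adj⇒Link {L = L} a)

size-liftMask : ∀ (L : List (Edge n)) D (as : All (IsEdgeOf (graphOf L)) D) →
                size L (liftMask L D as) ≤ length D
size-liftMask L [] [] = ≤-reflexive (cong length (select-∅ L))
size-liftMask L (e ∷ D) (a ∷ as) =
  ≤-trans (size-⊕ L (only p) (liftMask L D as))
          (+-mono-≤ (≤-reflexive (cong length (select-only p))) (size-liftMask L D as))
  where p = proj₂ (Adj⇒Link {L = L} a)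

liftMask-apart : ∀ (L : List (Edge n)) D (as : All (IsEdgeOf (graphOf L)) D) {P} (q : Any P L) →
                 All (λ e′ → Apart e′ (Any.lookup q)) D → liftMask L D as (pos q) ≡ false
liftMask-apart L [] [] q [] = refl
liftMask-apart L (e′ ∷ D) (a ∷ as) q ((z , apart) ∷ aparts)
  with only (proj₂ (Adj⇒Link {L = L} a)) (pos q) in at-q
... | true =
  ⊥-elim (apart (trans (sym (ends-Joins (lookup-result p) z)) (cong (λ e → ends e z) (only-pos⇒lookup p q at-q))))
  where p = proj₂ (Adj⇒Link {L = L} a)
... | false = liftMask-apart L D as q aparts

liftMask-head : ∀ (L : List (Edge n)) e D (a : IsEdgeOf (graphOf L) e) (as : All (IsEdgeOf (graphOf L)) D) →
                All (λ e′ → Apart e′ e) D → liftMask L (e ∷ D) (a ∷ as) (pos (proj₂ (Adj⇒Link {L = L} a))) ≡ true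
liftMask-head L e D a as aparts = cong₂ _xor_ (only-pos p) (liftMask-apart L D as p (All.map apart-lookup aparts))
  where
  p = proj₂ (Adj⇒Link {L = L} a)
  apart-lookup : ∀ {e′} → Apart e′ e → Apart e′ (Any.lookup p)
  apart-lookup (z , apart) = z , λ eq → apart (trans eq (ends-Joins (lookup-result p) z))

pathEdges : ∀ ℓ → (Fin (suc ℓ) → Fin n) → List (Edge n)
pathEdges zero g = []
pathEdges (suc ℓ) g = (g Fin.zero , g (Fin.suc Fin.zero)) ∷ pathEdges ℓ (g ∘ Fin.suc)

pathEdges-length : ∀ ℓ (g : Fin (suc ℓ) → Fin n) → length (pathEdges ℓ g) ≡ ℓ
pathEdges-length zero g = refl
pathEdges-length (suc ℓ) g = cong suc (pathEdges-length ℓ (g ∘ Fin.suc))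

∂-pathEdges : ∀ ℓ (g : Fin (suc ℓ) → Fin n) w → ∂ (pathEdges ℓ g) w ≡ ends (g Fin.zero , g (fromℕ ℓ)) w
∂-pathEdges zero g w = sym (xor-same (w == g Fin.zero))
∂-pathEdges (suc ℓ) g w =
  trans (cong (ends (g Fin.zero , g (Fin.suc Fin.zero)) w xor_) (∂-pathEdges ℓ (g ∘ Fin.suc) w))
        (telescope (w == g Fin.zero) (w == g (Fin.suc Fin.zero)) (w == g (fromℕ (suc ℓ))))
  where
  telescope : ∀ a b c → (a xor b) xor (b xor c) ≡ a xor c
  telescope = solve-xor 3 (λ a b c → (a :+ b) :+ (b :+ c) := a :+ c) refl

pathEdges-edges : ∀ {H : Graph n} ℓ (g : Fin (suc ℓ) → Fin n) → (∀ i → Adj H (g (inject₁ i)) (g (Fin.suc i))) →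
                  All (IsEdgeOf H) (pathEdges ℓ g)
pathEdges-edges zero g adjacent = []
pathEdges-edges {H = H} (suc ℓ) g adjacent =
  adjacent Fin.zero ∷ pathEdges-edges {H = H} ℓ (g ∘ Fin.suc) (adjacent ∘ Fin.suc)

pathEdges-avoid : ∀ ℓ (g : Fin (suc ℓ) → Fin n) {z} → (∀ i → g i ≢ z) →
                  All (λ e → ends e z ≡ false) (pathEdges ℓ g)
pathEdges-avoid zero g avoid = []
pathEdges-avoid (suc ℓ) g avoid =
  ends-off (λ z≡g₀ → avoid Fin.zero (sym z≡g₀)) (λ z≡g₁ → avoid (Fin.suc Fin.zero) (sym z≡g₁))
  ∷ pathEdges-avoid ℓ (g ∘ Fin.suc) (avoid ∘ Fin.suc)

module CycleEdges {H : Graph n} {m} (C : Cycle H m) where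

  open Cycle C

  v₀ v₁ vₗ : Fin n
  v₀ = vtx Fin.zero
  v₁ = vtx (Fin.suc Fin.zero)
  vₗ = vtx (fromℕ (suc (suc m)))

  inj-≢ : ∀ {i j} → i ≢ j → vtx i ≢ vtx j
  inj-≢ i≢j eq = i≢j (inj eq)

  first : Edge n
  first = (v₀ , v₁)

  rest : List (Edge n)
  rest = (vₗ , v₀) ∷ pathEdges (suc m) (vtx ∘ Fin.suc)

  first-edge : IsEdgeOf H first
  first-edge = cons Fin.zero

  rest-edges : All (IsEdgeOf H) rest
  rest-edges = close ∷ pathEdges-edges {H = H} (suc m) (vtx ∘ Fin.suc) (cons ∘ Fin.suc)

  length-edges : length (first ∷ rest) ≡ suc (suc (suc m))
  length-edges = cong (suc ∘ suc) (pathEdges-length (suc m) (vtx ∘ Fin.suc))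

  ∂-edges : ∀ w → ∂ (first ∷ rest) w ≡ false
  ∂-edges w =
    trans (cong (λ c → ends first w xor (ends (vₗ , v₀) w xor c)) (∂-pathEdges (suc m) (vtx ∘ Fin.suc) w))
          (cancel (w == v₀) (w == v₁) (w == vₗ))
    where
    cancel : ∀ a b c → (a xor b) xor ((c xor a) xor (b xor c)) ≡ false
    cancel = solve-xor 3 (λ a b c → (a :+ b) :+ ((c :+ a) :+ (b :+ c)) := con false) refl

  -- The closing edge misses v₁ and the other edges miss v₀, while the first edge meets both.
  rest-apart : All (λ e → Apart e first) rest
  rest-apart = apart-at v₁ (ends-off (inj-≢ λ ()) (inj-≢ λ ())) (ends-right v₀≢v₁)
             ∷ All.map (λ off → apart-at v₀ off (ends-left v₀≢v₁))
                       (pathEdges-avoid (suc m) (vtx ∘ Fin.suc) λ i → inj-≢ λ ())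
    where
    v₀≢v₁ : v₀ ≢ v₁
    v₀≢v₁ = inj-≢ λ ()

-- The edges of a cycle form an even list in which the first edge occurs once, so they lift
-- to a nonempty even subset of L.
greedy-girth : ∀ {k} {L : List (Edge n)} → Greedy k L → GirthAtLeast (k + 2) (graphOf L)
greedy-girth {k = k} {L} g m C = begin
  k + 2                  ≤⟨ greedy-even-size g even nonempty ⟩
  size L χ               ≤⟨ size-liftMask L (first ∷ rest) (first-edge ∷ rest-edges) ⟩
  length (first ∷ rest)  ≡⟨ length-edges ⟩
  suc (suc (suc m))      ∎
  where
  open CycleEdges C
  open ≤-Reasoning
  χ = liftMask L (first ∷ rest) (first-edge ∷ rest-edges)
  even : Even L χ
  even w = trans (∂-liftMask L (first ∷ rest) (first-edge ∷ rest-edges) w) (∂-edges w)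
  p₀ = proj₂ (Adj⇒Link {L = L} first-edge)
  nonempty : 1 ≤ size L χ
  nonempty = bit⇒nonempty L (pos p₀) (toℕ<n (Any.index p₀)) (liftMask-head L first rest first-edge rest-edges rest-apart)

∑-ones : ∀ m → ∑ {m} (λ _ → 1) ≡ m
∑-ones zero = refl
∑-ones (suc m) = cong suc (∑-ones m)

∑-update : ∀ {m} (f g : Fin (suc m) → ℕ) r → (∀ x → x ≢ r → f x ≡ g x) → ∑ f + g r ≡ ∑ g + f r
∑-update f g r agree = begin
  ∑ f + g r                             ≡⟨ cong (_+ g r) (sum-remove {i = r} f) ⟩
  f r + ∑ (removeAt f r) + g r          ≡⟨ cong (λ s → f r + s + g r) (sum-cong-≗ λ j → agree _ (punchInᵢ≢i r j)) ⟩
  f r + ∑ (removeAt g r) + g r          ≡⟨ swap (f r) (∑ (removeAt g r)) (g r) ⟩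
  g r + ∑ (removeAt g r) + f r          ≡⟨ cong (_+ f r) (sum-remove {i = r} g) ⟨
  ∑ g + f r                             ∎
  where
  open ≡-Reasoning
  swap : ∀ x y z → x + y + z ≡ z + y + x
  swap = solve-∀

∑-mono-≤ : ∀ {m} {f g : Fin m → ℕ} → (∀ i → f i ≤ g i) → ∑ f ≤ ∑ g
∑-mono-≤ {zero} _ = z≤n
∑-mono-≤ {suc m} f≤g = +-mono-≤ (f≤g Fin.zero) (∑-mono-≤ (f≤g ∘ Fin.suc))

∑-delta : ∀ {m} (c : Fin m) → ∑ (λ v → indicator (v == c)) ≡ 1
∑-delta {suc m} c = begin
  ∑ f                         ≡⟨ +-identityʳ (∑ f) ⟨
  ∑ f + 0                     ≡⟨ ∑-update f (λ _ → 0) c (λ v v≢c → cong indicator (dec-false (v ≟ c) v≢c)) ⟩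
  ∑ {suc m} (λ _ → 0) + f c   ≡⟨ cong₂ _+_ (sum-replicate-zero (suc m)) (cong indicator (dec-true (c ≟ c) refl)) ⟩
  1                           ∎
  where
  open ≡-Reasoning
  f : Fin (suc m) → ℕ
  f v = indicator (v == c)

∑∑-delta : ∀ {m} (a b : Fin m) → ∑ (λ i → ∑ (λ j → indicator ((i == a) ∧ (j == b)))) ≡ 1
∑∑-delta {m} a b = trans (sum-cong-≗ row) (∑-delta a)
  where
  row : ∀ i → ∑ (λ j → indicator ((i == a) ∧ (j == b))) ≡ indicator (i == a)
  row i with i == a
  ... | true = ∑-delta b
  ... | false = sum-replicate-zero m

-- Connected components

-- Every vertex carries the label of a representative of its component; an edge (a , b)
-- relabels the component of b with the label of a.

label : List (Edge n) → Fin n → Fin n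
label [] v = v
label ((a , b) ∷ R) v = if label R v == label R b then label R a else label R v

closings : List (Edge n) → ℕ
closings [] = 0
closings ((a , b) ∷ R) = if label R a == label R b then suc (closings R) else closings R

roots : List (Edge n) → ℕ
roots L = ∑ λ v → indicator (label L v == v)

label-idem : ∀ (L : List (Edge n)) v → label L (label L v) ≡ label L v
label-idem [] v = refl
label-idem ((a , b) ∷ R) v with label R v ≟ label R b
... | yes _ rewrite label-idem R a = if-eta (label R a == label R b)
... | no v≁b rewrite label-idem R v | dec-false (label R v ≟ label R b) v≁b = refl

label-∷-cong : ∀ a b (R : List (Edge n)) {u v} → label R u ≡ label R v →
               label ((a , b) ∷ R) u ≡ label ((a , b) ∷ R) v
label-∷-cong a b R same rewrite same = refl

label-ends : ∀ a b (R : List (Edge n)) → label ((a , b) ∷ R) a ≡ label ((a , b) ∷ R) b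
label-ends a b R rewrite dec-true (label R b ≟ label R b) refl = if-eta (label R a == label R b)

joined⇒sameLabel : ∀ {L : List (Edge n)} {u v} → Any (Joins u v) L → label L u ≡ label L v
joined⇒sameLabel {L = (a , b) ∷ R} (Any.here (inj₁ refl)) = label-ends a b R
joined⇒sameLabel {L = (a , b) ∷ R} (Any.here (inj₂ refl)) = sym (label-ends a b R)
joined⇒sameLabel {L = (a , b) ∷ R} (Any.there p) = label-∷-cong a b R (joined⇒sameLabel p)

label-∷-closing : ∀ a b (R : List (Edge n)) → label R a ≡ label R b →
                  ∀ v → label ((a , b) ∷ R) v ≡ label R v
label-∷-closing a b R a∼b v with label R v ≟ label R b
... | yes v∼b = trans a∼b (sym v∼b)
... | no _ = refl

isRoot-∷-merging : ∀ a b (R : List (Edge n)) → label R a ≢ label R b → ∀ x → x ≢ label R b →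
                   (label ((a , b) ∷ R) x == x) ≡ (label R x == x)
isRoot-∷-merging a b R a≁b x x≢r with label R x ≟ label R b
... | no _ = refl
... | yes x∼b =
  trans (dec-false (label R a ≟ x) a≢x) (sym (dec-false (label R x ≟ x) λ q → x≢r (trans (sym q) x∼b)))
  where
  a≢x : label R a ≢ x
  a≢x q = a≁b (trans (sym (label-idem R a)) (trans (cong (label R) q) x∼b))

-- A merging edge turns exactly one root, the label of b, into a non-root.
roots-∷-merging : ∀ {m} a b (R : List (Edge (suc m))) → label R a ≢ label R b →
                  suc (roots ((a , b) ∷ R)) ≡ roots R
roots-∷-merging a b R a≁b = begin
  suc (roots L)   ≡⟨ +-comm 1 (roots L) ⟩
  roots L + 1     ≡⟨ cong (roots L +_) r-root-in-R ⟨
  roots L + f r   ≡⟨ ∑-update g f r (λ x x≢r → cong indicator (isRoot-∷-merging a b R a≁b x x≢r)) ⟩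
  roots R + g r   ≡⟨ cong (roots R +_) r-not-root-in-L ⟩
  roots R + 0     ≡⟨ +-identityʳ (roots R) ⟩
  roots R         ∎
  where
  open ≡-Reasoning
  L = (a , b) ∷ R
  r = label R b
  f g : Fin _ → ℕ
  f v = indicator (label R v == v)
  g v = indicator (label L v == v)
  r-root-in-R : f r ≡ 1
  r-root-in-R = cong indicator (dec-true (label R r ≟ r) (label-idem R b))
  r-not-root-in-L : g r ≡ 0
  r-not-root-in-L rewrite label-idem R b | dec-true (label R b ≟ label R b) refl
                        | dec-false (label R a ≟ label R b) a≁b = refl

-- Each edge either merges two components (losing a root) or closes a cycle.
roots-closings : ∀ (L : List (Edge n)) → roots L + length L ≡ n + closings L
roots-closings {n} [] = begin
  roots {n} [] + 0                   ≡⟨ +-identityʳ (roots {n} []) ⟩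
  ∑ {n} (λ v → indicator (v == v))   ≡⟨ sum-cong-≗ {n} (λ v → cong indicator (dec-true (v ≟ v) refl)) ⟩
  ∑ {n} (λ _ → 1)                    ≡⟨ ∑-ones n ⟩
  n                                  ≡⟨ +-identityʳ n ⟨
  n + 0                              ∎
  where open ≡-Reasoning
roots-closings {suc m} ((a , b) ∷ R) with label R a ≟ label R b
... | yes a∼b = begin
  roots L + suc (length R)     ≡⟨ cong (_+ suc (length R)) (sum-cong-≗ same-roots) ⟩
  roots R + suc (length R)     ≡⟨ +-suc (roots R) (length R) ⟩
  suc (roots R + length R)     ≡⟨ cong suc (roots-closings R) ⟩
  suc (suc m + closings R)     ≡⟨ +-suc (suc m) (closings R) ⟨
  suc m + suc (closings R)     ∎
  where
  open ≡-Reasoning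
  L = (a , b) ∷ R
  same-roots : ∀ v → indicator (label L v == v) ≡ indicator (label R v == v)
  same-roots v = cong (λ c → indicator (c == v)) (label-∷-closing a b R a∼b v)
... | no a≁b = begin
  roots L + suc (length R)     ≡⟨ +-suc (roots L) (length R) ⟩
  suc (roots L) + length R     ≡⟨ cong (_+ length R) (roots-∷-merging a b R a≁b) ⟩
  roots R + length R           ≡⟨ roots-closings R ⟩
  suc m + closings R           ∎
  where
  open ≡-Reasoning
  L = (a , b) ∷ R

roots-pos : ∀ {m} (L : List (Edge (suc m))) → 1 ≤ roots L
roots-pos L = subst (1 ≤_) (sym (sum-remove {i = r} f)) (≤-trans (≤-reflexive (sym r-root)) (m≤m+n (f r) _))
  where
  f : Fin _ → ℕ
  f v = indicator (label L v == v)
  r = label L Fin.zero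
  r-root : indicator (label L r == r) ≡ 1
  r-root = cong indicator (dec-true (label L r ≟ r) (label-idem L Fin.zero))

length≤n₀+closings : ∀ {n₀} (L : List (Edge (suc n₀))) → length L ≤ n₀ + closings L
length≤n₀+closings L = s≤s⁻¹ (≤-trans (+-monoˡ-≤ (length L) (roots-pos L)) (≤-reflexive (roots-closings L)))

Chain : List (Edge n) → Fin n → Fin n → Set
Chain R u v = ∃ λ ψ → ∀ w → ∂ (select R ψ) w ≡ ends (u , v) w

chain-skip : ∀ e (R : List (Edge n)) {u v} → Chain R u v → Chain (e ∷ R) u v
chain-skip e R (ψ , bd) = false ◂ ψ , bd

chain-through : ∀ {e} {R : List (Edge n)} {x y u v} → Joins x y e →
                Chain R u x → Chain R y v → Chain (e ∷ R) u v
chain-through {e = e} {R} {x} {y} {u} {v} xy (ψ₁ , bd₁) (ψ₂ , bd₂) = true ◂ (ψ₁ ⊕ ψ₂) , λ w → begin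
  ends e w xor ∂ (select R (ψ₁ ⊕ ψ₂)) w                    ≡⟨ cong (ends e w xor_) (∂-select-⊕ R ψ₁ ψ₂ w) ⟩
  ends e w xor (∂ (select R ψ₁) w xor ∂ (select R ψ₂) w)   ≡⟨ cong₂ _xor_ (ends-Joins xy w)
                                                                    (cong₂ _xor_ (bd₁ w) (bd₂ w)) ⟩
  ends (x , y) w xor (ends (u , x) w xor ends (y , v) w)   ≡⟨ telescope (w == x) (w == y) (w == u) (w == v) ⟩
  ends (u , v) w                                           ∎
  where
  open ≡-Reasoning
  telescope : ∀ x y u v → (x xor y) xor ((u xor x) xor (y xor v)) ≡ u xor v
  telescope = solve-xor 4 (λ x y u v → (x :+ y) :+ ((u :+ x) :+ (y :+ v)) := u :+ v) refl

sameLabel⇒chain : ∀ (R : List (Edge n)) {u v} → label R u ≡ label R v → Chain R u v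
sameLabel⇒chain [] {u} refl = ∅ , λ w → sym (xor-same (w == u))
sameLabel⇒chain ((a , b) ∷ R) {u} {v} same with label R u ≟ label R b | label R v ≟ label R b
... | yes u∼b | yes v∼b = chain-skip (a , b) R (sameLabel⇒chain R (trans u∼b (sym v∼b)))
... | no _ | no _ = chain-skip (a , b) R (sameLabel⇒chain R same)
... | yes u∼b | no _ = chain-through {R = R} (inj₂ refl) (sameLabel⇒chain R u∼b) (sameLabel⇒chain R same)
... | no _ | yes v∼b = chain-through {R = R} (inj₁ refl) (sameLabel⇒chain R same) (sameLabel⇒chain R (sym v∼b))

-- Three independent cycles

record Leading {A : Set} (L : List A) (χ : Mask) (d : ℕ) : Set where
  constructor leading
  field
    inside : d < length L
    top : χ d ≡ true
    below : ∀ i → i < d → χ i ≡ false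

Vanishes : Mask → ℕ → Set
Vanishes ψ d = ∀ i → i ≤ d → ψ i ≡ false

CycleAt : List (Edge n) → ℕ → Set
CycleAt L d = ∃ λ χ → Even L χ × Leading L χ d

leading⇒vanishes : ∀ {A : Set} {L : List A} {ψ d d′} → Leading L ψ d′ → d < d′ → Vanishes ψ d
leading⇒vanishes (leading _ _ below) d<d′ i i≤d = below i (≤-<-trans i≤d d<d′)

vanishes-⊕ : ∀ {χ ψ d} → Vanishes χ d → Vanishes ψ d → Vanishes (χ ⊕ ψ) d
vanishes-⊕ vχ vψ i i≤d = cong₂ _xor_ (vχ i i≤d) (vψ i i≤d)

leading-⊕ : ∀ {A : Set} {L : List A} {χ ψ d} → Leading L χ d → Vanishes ψ d → Leading L (χ ⊕ ψ) d
leading-⊕ {ψ = ψ} {d} (leading d<n top below) vψ =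
  leading d<n (cong₂ _xor_ top (vψ d ≤-refl)) λ i i<d → cong₂ _xor_ (below i i<d) (vψ i (<⇒≤ i<d))

cycle-here : ∀ a b (R : List (Edge n)) → label R a ≡ label R b → CycleAt ((a , b) ∷ R) 0
cycle-here a b R a∼b = true ◂ ψ , even , leading (s≤s z≤n) refl λ _ ()
  where
  ψ = proj₁ (sameLabel⇒chain R a∼b)
  even : Even ((a , b) ∷ R) (true ◂ ψ)
  even w = trans (cong (ends (a , b) w xor_) (proj₂ (sameLabel⇒chain R a∼b) w)) (xor-same (ends (a , b) w))

cycle-there : ∀ e (R : List (Edge n)) {d} → CycleAt R d → CycleAt (e ∷ R) (suc d)
cycle-there e R (χ , even , leading d<n top below) = false ◂ χ , even , leading (s≤s d<n) top below′
  where
  below′ : ∀ i → i < suc _ → (false ◂ χ) i ≡ false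
  below′ zero _ = refl
  below′ (suc i) (s≤s i<d) = below i i<d

closings-∷-closing : ∀ a b (R : List (Edge n)) → label R a ≡ label R b →
                     closings ((a , b) ∷ R) ≡ suc (closings R)
closings-∷-closing a b R a∼b rewrite dec-true (label R a ≟ label R b) a∼b = refl

closing-cycle : ∀ {L : List (Edge n)} → 1 ≤ closings L → ∃ (CycleAt L)
closing-cycle {L = []} ()
closing-cycle {L = (a , b) ∷ R} one with label R a ≟ label R b
... | yes a∼b = 0 , cycle-here a b R a∼b
... | no _ = Product.map suc (cycle-there (a , b) R) (closing-cycle {L = R} one)

two-closing-cycles : ∀ {L : List (Edge n)} → 2 ≤ closings L →
                     ∃₂ λ d d′ → d < d′ × CycleAt L d × CycleAt L d′
two-closing-cycles {L = []} ()
two-closing-cycles {L = (a , b) ∷ R} two with label R a ≟ label R b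
... | yes a∼b = let (d′ , c′) = closing-cycle {L = R} (s≤s⁻¹ two) in
  0 , suc d′ , s≤s z≤n , cycle-here a b R a∼b , cycle-there (a , b) R c′
... | no _ = let (d , d′ , d<d′ , c , c′) = two-closing-cycles {L = R} two in
  suc d , suc d′ , s≤s d<d′ , cycle-there (a , b) R c , cycle-there (a , b) R c′

count-at : List Mask → ℕ → ℕ
count-at Xs i = sum (map (λ χ → indicator (χ i)) Xs)

sizes-∷ : ∀ {A : Set} x (xs : List A) Xs →
          sum (map (size (x ∷ xs)) Xs) ≡ count-at Xs 0 + sum (map (size xs) (map (_∘ suc) Xs))
sizes-∷ x xs [] = refl
sizes-∷ x xs (χ ∷ Xs) = trans (cong₂ _+_ (size-∷ x xs χ) (sizes-∷ x xs Xs))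
  (+-interchange (indicator (χ 0)) (size xs (χ ∘ suc)) (count-at Xs 0) (sum (map (size xs) (map (_∘ suc) Xs))))

total-size-≤ : ∀ {A : Set} (L : List A) Xs {c} → (∀ i → count-at Xs i ≤ c) →
               sum (map (size L) Xs) ≤ length L * c
total-size-≤ {A} [] Xs _ = ≤-reflexive (sum-zeros Xs)
  where
  sum-zeros : ∀ Xs → sum (map (size {A = A} []) Xs) ≡ 0
  sum-zeros [] = refl
  sum-zeros (_ ∷ Xs) = sum-zeros Xs
total-size-≤ (x ∷ xs) Xs {c} bounded = begin
  sum (map (size (x ∷ xs)) Xs)                           ≡⟨ sizes-∷ x xs Xs ⟩
  count-at Xs 0 + sum (map (size xs) (map (_∘ suc) Xs))  ≤⟨ +-mono-≤ (bounded 0) (total-size-≤ xs Xs′ shifted) ⟩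
  c + length xs * c                                      ∎
  where
  open ≤-Reasoning
  Xs′ = map (_∘ suc) Xs
  shifted : ∀ i → count-at Xs′ i ≤ c
  shifted i = subst (_≤ c) (cong sum (map-∘ Xs)) (bounded (suc i))

sum-map-≥ : ∀ {A : Set} {f : A → ℕ} {m} {xs} → All (λ x → m ≤ f x) xs → length xs * m ≤ sum (map f xs)
sum-map-≥ [] = z≤n
sum-map-≥ (m≤fx ∷ rest) = +-mono-≤ m≤fx (sum-map-≥ rest)

span₃ : Mask → Mask → Mask → List Mask
span₃ χ₁ χ₂ χ₃ = χ₁ ∷ χ₂ ∷ χ₃ ∷ χ₁ ⊕ χ₂ ∷ χ₁ ⊕ χ₃ ∷ χ₂ ⊕ χ₃ ∷ χ₁ ⊕ (χ₂ ⊕ χ₃) ∷ []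

-- A nonzero vector of GF(2)³ has odd inner product with exactly four of the seven nonzero vectors.
count-at-span₃ : ∀ χ₁ χ₂ χ₃ i → count-at (span₃ χ₁ χ₂ χ₃) i ≤ 4
count-at-span₃ χ₁ χ₂ χ₃ i = four (χ₁ i) (χ₂ i) (χ₃ i)
  where
  four : ∀ a b c → count-at (span₃ (λ _ → a) (λ _ → b) (λ _ → c)) 0 ≤ 4
  four false false false = z≤n
  four false false true = ≤-refl
  four false true false = ≤-refl
  four false true true = ≤-refl
  four true false false = ≤-refl
  four true false true = ≤-refl
  four true true false = ≤-refl
  four true true true = ≤-refl

-- The seven nonzero combinations of three cycles with distinct leading edges are nonempty
-- even subsets, so each has at least k + 2 edges, while together they use every edge at most four times.
three-cycles-bound : ∀ {k} {L : List (Edge n)} {d₁ d₂ d₃} → Greedy k L →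
                     CycleAt L d₁ → CycleAt L d₂ → CycleAt L d₃ → d₁ < d₂ → d₂ < d₃ →
                     7 * (k + 2) ≤ length L * 4
three-cycles-bound {k = k} {L} g (χ₁ , ev₁ , ld₁) (χ₂ , ev₂ , ld₂) (χ₃ , ev₃ , ld₃) d₁<d₂ d₂<d₃ =
  ≤-trans (sum-map-≥ each-large) (total-size-≤ L (span₃ χ₁ χ₂ χ₃) (count-at-span₃ χ₁ χ₂ χ₃))
  where
  _⊕ᵉ_ : ∀ {χ ψ} → Even L χ → Even L ψ → Even L (χ ⊕ ψ)
  _⊕ᵉ_ = Even-⊕ {L = L}
  large : ∀ {χ d} → Even L χ → Leading L χ d → k + 2 ≤ size L χ
  large ev ld = greedy-even-size g ev (bit⇒nonempty L _ (Leading.inside ld) (Leading.top ld))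
  χ₂-below-d₁ = leading⇒vanishes ld₂ d₁<d₂
  χ₃-below-d₁ = leading⇒vanishes ld₃ (<-trans d₁<d₂ d₂<d₃)
  χ₃-below-d₂ = leading⇒vanishes ld₃ d₂<d₃
  each-large : All (λ χ → k + 2 ≤ size L χ) (span₃ χ₁ χ₂ χ₃)
  each-large = large ev₁ ld₁
             ∷ large ev₂ ld₂
             ∷ large ev₃ ld₃
             ∷ large (ev₁ ⊕ᵉ ev₂) (leading-⊕ ld₁ χ₂-below-d₁)
             ∷ large (ev₁ ⊕ᵉ ev₃) (leading-⊕ ld₁ χ₃-below-d₁)
             ∷ large (ev₂ ⊕ᵉ ev₃) (leading-⊕ ld₂ χ₃-below-d₂)
             ∷ large (ev₁ ⊕ᵉ (ev₂ ⊕ᵉ ev₃)) (leading-⊕ ld₁ (vanishes-⊕ {χ₂} {χ₃} χ₂-below-d₁ χ₃-below-d₁))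
             ∷ []

three-closings-bound : ∀ {k n₀} {L : List (Edge (suc n₀))} → Greedy k L → 3 ≤ closings L →
                       7 * (k + 2) ≤ (n₀ + 3) * 4
three-closings-bound {k} {n₀} {(a , b) ∷ R} (far ∷ g) three with label R a ≟ label R b
... | no _ = three-closings-bound g three
... | yes a∼b with 3 ≤? closings R
...   | yes three′ = three-closings-bound g three′
...   | no fewer with two-closing-cycles {L = R} (s≤s⁻¹ three)
...     | d₂ , d₃ , d₂<d₃ , c₂ , c₃ = begin
  7 * (k + 2)             ≤⟨ three-cycles-bound (far ∷ g) (cycle-here a b R a∼b) (cycle-there (a , b) R c₂)
                                                (cycle-there (a , b) R c₃) (s≤s z≤n) (s≤s d₂<d₃) ⟩
  length L * 4            ≤⟨ *-monoˡ-≤ 4 (length≤n₀+closings L) ⟩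
  (n₀ + closings L) * 4   ≡⟨ cong (λ c → (n₀ + c) * 4) closings≡3 ⟩
  (n₀ + 3) * 4            ∎
  where
  open ≤-Reasoning
  L = (a , b) ∷ R
  closings≡3 : closings L ≡ 3
  closings≡3 = trans (closings-∷-closing a b R a∼b) (cong suc (≤-antisym (s≤s⁻¹ (≰⇒> fewer)) (s≤s⁻¹ three)))

too-many-edges : ∀ n₀ k → 4 * suc n₀ < 7 * k → ¬ 7 * (k + 2) ≤ (n₀ + 3) * 4
too-many-edges n₀ k k-large bound = contradiction (+-cancelˡ-≤ (4 * n₀ + 12) 7 0 chain) λ ()
  where
  open ≤-Reasoning
  e₁ : ∀ n₀ → 4 * n₀ + 12 + 7 ≡ suc (4 * suc n₀) + 14
  e₁ = solve-∀
  e₂ : ∀ k → 7 * k + 14 ≡ 7 * (k + 2)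
  e₂ = solve-∀
  e₃ : ∀ n₀ → (n₀ + 3) * 4 ≡ 4 * n₀ + 12 + 0
  e₃ = solve-∀
  chain : 4 * n₀ + 12 + 7 ≤ 4 * n₀ + 12 + 0
  chain = begin
    4 * n₀ + 12 + 7         ≡⟨ e₁ n₀ ⟩
    suc (4 * suc n₀) + 14   ≤⟨ +-monoˡ-≤ 14 k-large ⟩
    7 * k + 14              ≡⟨ e₂ k ⟩
    7 * (k + 2)             ≤⟨ bound ⟩
    (n₀ + 3) * 4            ≡⟨ e₃ n₀ ⟩
    4 * n₀ + 12 + 0         ∎

greedy-closings≤2 : ∀ {k n₀} {L : List (Edge (suc n₀))} → Greedy k L → 4 * suc n₀ < 7 * k → closings L ≤ 2
greedy-closings≤2 {k} {n₀} {L} g k-large with 3 ≤? closings L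
... | no fewer = s≤s⁻¹ (≰⇒> fewer)
... | yes three = ⊥-elim (too-many-edges n₀ k k-large (three-closings-bound g three))

sum-map-tabulate : ∀ {m} {A : Set} (f : A → ℕ) (g : Fin m → A) → sum (map f (tabulate g)) ≡ ∑ (f ∘ g)
sum-map-tabulate {zero} f g = refl
sum-map-tabulate {suc m} f g = cong (f (g Fin.zero) +_) (sum-map-tabulate f (g ∘ Fin.suc))

ordered : Graph n → Fin n → Fin n → Bool
ordered G i j = (toℕ i <ᵇ toℕ j) ∧ adj G i j

numEdges-∑ : ∀ (G : Graph n) → numEdges G ≡ ∑ λ i → ∑ λ j → indicator (ordered G i j)
numEdges-∑ {n} G =
  trans (sum-map-tabulate row id) (sum-cong-≗ λ i → sum-map-tabulate (λ j → indicator (ordered G i j)) id)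
  where
  row : Fin n → ℕ
  row i = sum (map (λ j → indicator (ordered G i j)) (allFin n))

<ᵇ-asym : ∀ m n → (m <ᵇ n) ≡ true → (n <ᵇ m) ≡ false
<ᵇ-asym zero (suc n) _ = refl
<ᵇ-asym (suc m) (suc n) m<n = <ᵇ-asym m n m<n

sorted : Edge n → Edge n
sorted (a , b) = if toℕ a <ᵇ toℕ b then (a , b) else (b , a)

-- Among ordered pairs, only the sorted form of the new edge can become adjacent.
ordered-∷ : ∀ e (R : List (Edge n)) i j →
            indicator (ordered (graphOf (e ∷ R)) i j)
            ≤ indicator (ordered (graphOf R) i j) + indicator ((i == proj₁ (sorted e)) ∧ (j == proj₂ (sorted e)))
ordered-∷ e R i j with toℕ i <ᵇ toℕ j in i<j | link? (e ∷ R) i j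
... | false | _ = z≤n
... | true | no _ = z≤n
... | true | yes (i≢j , Any.there p) rewrite dec-true (link? R i j) (i≢j , p) = s≤s z≤n
... | true | yes (_ , Any.here (inj₁ refl))
  rewrite i<j | dec-true (i ≟ i) refl | dec-true (j ≟ j) refl = m≤n+m 1 _
... | true | yes (_ , Any.here (inj₂ refl))
  rewrite <ᵇ-asym (toℕ i) (toℕ j) i<j | dec-true (i ≟ i) refl | dec-true (j ≟ j) refl = m≤n+m 1 _

numEdges-∷ : ∀ e (R : List (Edge n)) → numEdges (graphOf (e ∷ R)) ≤ numEdges (graphOf R) + 1
numEdges-∷ e R = begin
  numEdges (graphOf (e ∷ R))                             ≡⟨ numEdges-∑ (graphOf (e ∷ R)) ⟩
  ∑ (λ i → ∑ λ j → indicator (ordered (graphOf (e ∷ R)) i j)) ≤⟨ ∑-mono-≤ (λ i → ∑-mono-≤ (ordered-∷ e R i)) ⟩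
  ∑ (λ i → ∑ λ j → old i j + new i j)                    ≡⟨ sum-cong-≗ (λ i → ∑-distrib-+ (old i) (new i)) ⟩
  ∑ (λ i → ∑ (old i) + ∑ (new i))                        ≡⟨ ∑-distrib-+ (λ i → ∑ (old i)) (λ i → ∑ (new i)) ⟩
  ∑ (λ i → ∑ (old i)) + ∑ (λ i → ∑ (new i))              ≡⟨ cong₂ _+_ (numEdges-∑ (graphOf R)) (sym (∑∑-delta a b)) ⟨
  numEdges (graphOf R) + 1                               ∎
  where
  open ≤-Reasoning
  a = proj₁ (sorted e)
  b = proj₂ (sorted e)
  old new : Fin _ → Fin _ → ℕ
  old i j = indicator (ordered (graphOf R) i j)
  new i j = indicator ((i == a) ∧ (j == b))

numEdges-graphOf : ∀ (L : List (Edge n)) → numEdges (graphOf L) ≤ length L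
numEdges-graphOf {n} [] = ≤-reflexive (begin
  numEdges (graphOf {n} [])                                ≡⟨ numEdges-∑ (graphOf {n} []) ⟩
  ∑ (λ i → ∑ λ j → indicator (ordered (graphOf {n} []) i j)) ≡⟨ sum-cong-≗ {n} (λ i → sum-cong-≗ {n} (λ j → cong indicator (none i j))) ⟩
  ∑ {n} (λ i → ∑ {n} λ j → 0)                              ≡⟨ sum-cong-≗ {n} (λ i → sum-replicate-zero n) ⟩
  ∑ {n} (λ i → 0)                                          ≡⟨ sum-replicate-zero n ⟩
  0                                                        ∎)
  where
  open ≡-Reasoning
  none : ∀ i j → ordered (graphOf {n} []) i j ≡ false
  none i j rewrite dec-false (link? [] i j) (λ ()) = ∧-zeroʳ (toℕ i <ᵇ toℕ j)
numEdges-graphOf (e ∷ R) =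
  ≤-trans (numEdges-∷ e R) (≤-trans (+-monoˡ-≤ 1 (numEdges-graphOf R)) (≤-reflexive (+-comm (length R) 1)))

edgeList : Graph n → List (Edge n)
edgeList {n} G = filter (λ e → T? (ordered G (proj₁ e) (proj₂ e))) (allPairs n)

length-filter-T? : ∀ {A : Set} (p : A → Bool) xs → length (filter (T? ∘ p) xs) ≡ sum (map (indicator ∘ p) xs)
length-filter-T? p [] = refl
length-filter-T? p (x ∷ xs) with p x
... | true = cong suc (length-filter-T? p xs)
... | false = length-filter-T? p xs

sum-cartesianProduct : ∀ {A B : Set} (h : A × B → ℕ) xs ys →
                       sum (map h (cartesianProduct xs ys)) ≡ sum (map (λ x → sum (map (λ y → h (x , y)) ys)) xs)
sum-cartesianProduct h [] ys = refl
sum-cartesianProduct h (x ∷ xs) ys = begin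
  sum (map h (map (x ,_) ys ++ cartesianProduct xs ys))               ≡⟨ cong sum (map-++ h (map (x ,_) ys) _) ⟩
  sum (map h (map (x ,_) ys) ++ map h (cartesianProduct xs ys))       ≡⟨ sum-++ (map h (map (x ,_) ys)) _ ⟩
  sum (map h (map (x ,_) ys)) + sum (map h (cartesianProduct xs ys))  ≡⟨ cong₂ _+_ (cong sum (sym (map-∘ ys)))
                                                                                   (sum-cartesianProduct h xs ys) ⟩
  sum (map (λ y → h (x , y)) ys) + sum (map (λ x → sum (map (λ y → h (x , y)) ys)) xs)  ∎
  where open ≡-Reasoning

numEdges≡length-edgeList : ∀ (G : Graph n) → numEdges G ≡ length (edgeList G)
numEdges≡length-edgeList {n} G =
  sym (trans (length-filter-T? p (allPairs n)) (sum-cartesianProduct (indicator ∘ p) (allFin n) (allFin n)))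
  where
  p : Edge n → Bool
  p e = ordered G (proj₁ e) (proj₂ e)

<ᵇ-true : ∀ {m n} → m < n → (m <ᵇ n) ≡ true
<ᵇ-true m<n = Equivalence.to T-≡ (<⇒<ᵇ m<n)

edge∈edgeList : ∀ {G : Graph n} {u v} → toℕ u < toℕ v → Adj G u v → (u , v) ∈ edgeList G
edge∈edgeList {n} {G} {u} {v} u<v uv =
  ∈-filter⁺ (λ e → T? (ordered G (proj₁ e) (proj₂ e))) (∈-cartesianProduct⁺ (∈-allFin u) (∈-allFin v))
            (Equivalence.from T-≡ (cong₂ _∧_ (<ᵇ-true u<v) uv))

adj⇒joined : ∀ {G : Graph n} {u v} → Adj G u v → Any (Joins u v) (edgeList G)
adj⇒joined {G = G} {u} {v} uv with <-cmp (toℕ u) (toℕ v)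
... | tri< u<v _ _ = Any.map (inj₁ ∘ sym) (edge∈edgeList {G = G} u<v uv)
... | tri≈ _ u≡v _ = ⊥-elim (Adj⇒≢ {H = G} uv (toℕ-injective u≡v))
... | tri> _ _ v<u = Any.map (inj₂ ∘ sym) (edge∈edgeList {G = G} v<u (Adj-sym {H = G} uv))

-- In the edge list of a connected graph all vertices end up with one label, so one root remains.
connected⇒edges : ∀ {n₀} (G : Graph (suc n₀)) → Connected G → n₀ ≤ numEdges G
connected⇒edges {n₀} G connected = begin
  n₀                      ≤⟨ m≤m+n n₀ (closings L) ⟩
  n₀ + closings L         ≡⟨ suc-injective (trans (cong (_+ length L) (sym one-root)) (roots-closings L)) ⟨
  length L                ≡⟨ numEdges≡length-edgeList G ⟨
  numEdges G              ∎
  where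
  open ≤-Reasoning
  L = edgeList G
  c = label L Fin.zero
  walk⇒sameLabel : ∀ {u v d} → Walk G u v d → label L u ≡ label L v
  walk⇒sameLabel here = refl
  walk⇒sameLabel (step uw W) = trans (joined⇒sameLabel (adj⇒joined {G = G} uw)) (walk⇒sameLabel W)
  one-root : roots L ≡ 1
  one-root = trans (sum-cong-≗ λ v → cong indicator (trans (cong (_== v) (walk⇒sameLabel (proj₂ (connected v Fin.zero))))
                                                           (does-⇔ (mk⇔ sym sym) (c ≟ v) (v ≟ c))))
                   (∑-delta c)

module GreedySpanner (G : Graph n) (k : ℕ) where

  Addable : List (Edge n) → Edge n → Set
  Addable L e = IsEdgeOf G e × ¬ ShortWalk (graphOf L) k (proj₁ e) (proj₂ e)

  addable? : ∀ L e → Dec (Addable L e)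
  addable? L (u , v) = (adj G u v Bool.≟ true) ×-dec ¬? (shortWalk? (graphOf L) k u v)

  add : Edge n → List (Edge n) → List (Edge n)
  add e L with addable? L e
  ... | yes _ = e ∷ L
  ... | no _ = L

  greedy : List (Edge n) → List (Edge n)
  greedy [] = []
  greedy (e ∷ Q) = add e (greedy Q)

  greedy-isGreedy : ∀ Q → Greedy k (greedy Q)
  greedy-isGreedy [] = []
  greedy-isGreedy (e ∷ Q) with addable? (greedy Q) e
  ... | yes (_ , far) = far ∷ greedy-isGreedy Q
  ... | no _ = greedy-isGreedy Q

  greedy⊆G : ∀ Q → All (IsEdgeOf G) (greedy Q)
  greedy⊆G [] = []
  greedy⊆G (e ∷ Q) with addable? (greedy Q) e
  ... | yes (inG , _) = inG ∷ greedy⊆G Q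
  ... | no _ = greedy⊆G Q

  add-⊇ : ∀ e L → Subgraph (graphOf L) (graphOf (add e L))
  add-⊇ e L with addable? L e
  ... | yes _ = graphOf-∷ e L
  ... | no _ = λ _ _ a → a

  add-covers : 1 ≤ k → ∀ e L → IsEdgeOf G e → ShortWalk (graphOf (add e L)) k (proj₁ e) (proj₂ e)
  add-covers 1≤k (u , v) L uv with addable? L (u , v)
  ... | yes _ = 1 , step (Link⇒Adj {L = (u , v) ∷ L} (Adj⇒≢ {H = G} uv , Any.here (inj₁ refl))) here , 1≤k
  ... | no ¬addable with shortWalk? (graphOf L) k u v
  ...   | yes short = short
  ...   | no far = ⊥-elim (¬addable (uv , far))

  greedy-covers : 1 ≤ k → ∀ Q {e} → e ∈ Q → IsEdgeOf G e → ShortWalk (graphOf (greedy Q)) k (proj₁ e) (proj₂ e)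
  greedy-covers 1≤k (e ∷ Q) (Any.here refl) inG = add-covers 1≤k e (greedy Q) inG
  greedy-covers 1≤k (e′ ∷ Q) (Any.there e∈Q) inG =
    let (d , W , d≤k) = greedy-covers 1≤k Q e∈Q inG in d , walk-map (add-⊇ e′ (greedy Q)) W , d≤k

  spannerEdges : List (Edge n)
  spannerEdges = greedy (allPairs n)

  H : Graph n
  H = graphOf spannerEdges

  H⊆G : Subgraph H G
  H⊆G u v a =
    let (inG , uv) = All.lookupAny (greedy⊆G (allPairs n)) (proj₂ (Adj⇒Link {L = spannerEdges} a))
    in Joins⇒Adj {H = G} uv inG

  H-stretch : 1 ≤ k → StretchAtMost k H G
  H-stretch 1≤k u .u .0 here = 0 , here , z≤n
  H-stretch 1≤k u v (suc d) (step {w = w} uw W) =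
    let (d₁ , W₁ , d₁≤k) = greedy-covers 1≤k _ (∈-cartesianProduct⁺ (∈-allFin u) (∈-allFin w)) uw
        (d₂ , W₂ , d₂≤kd) = H-stretch 1≤k w v d W
    in d₁ + d₂ , walk-++ W₁ W₂ , ≤-trans (+-mono-≤ d₁≤k d₂≤kd) (≤-reflexive (sym (*-suc k d)))

greedy-numEdges : ∀ {k n₀} {L : List (Edge (suc n₀))} → Greedy k L → 4 * suc n₀ < 7 * k →
                  numEdges (graphOf L) ≤ n₀ + 2
greedy-numEdges {n₀ = n₀} {L} g k-large =
  ≤-trans (numEdges-graphOf L) (≤-trans (length≤n₀+closings L) (+-monoʳ-≤ n₀ (greedy-closings≤2 g k-large)))

spanner-connected : ∀ {k} {G H : Graph n} → Connected G → StretchAtMost k H G → Connected H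
spanner-connected connected stretch u v =
  let (d , W) = connected u v ; (d′ , W′ , _) = stretch u v d W in d′ , W′

approxGood : ∀ n k → 1 ≤ n → 4 * n < 7 * k → ApproxGood 2 3 n k
approxGood (suc n₀) (suc k′) _ k-large G connected =
  H , (H⊆G , H-stretch (s≤s z≤n)) , greedy-girth greedy-H , bound
  where
  k = suc k′
  open GreedySpanner G k
  greedy-H : Greedy k spannerEdges
  greedy-H = greedy-isGreedy (allPairs (suc n₀))
  open ≤-Reasoning
  rearrange : ∀ n₀ → n₀ + 2 + 2 * suc n₀ ≡ 2 * n₀ + suc n₀ + 3
  rearrange = solve-∀
  bound : ∀ H′ → IsSpanner k H′ G → numEdges H + 2 * suc n₀ ≤ 2 * numEdges H′ + suc n₀ + 3
  bound H′ (_ , stretch) = begin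
    numEdges H + 2 * suc n₀        ≤⟨ +-monoˡ-≤ (2 * suc n₀) (greedy-numEdges greedy-H k-large) ⟩
    n₀ + 2 + 2 * suc n₀            ≡⟨ rearrange n₀ ⟩
    2 * n₀ + suc n₀ + 3            ≤⟨ +-monoˡ-≤ 3 (+-monoˡ-≤ (suc n₀) (*-monoʳ-≤ 2 H′-large)) ⟩
    2 * numEdges H′ + suc n₀ + 3   ∎
    where
    H′-large : n₀ ≤ numEdges H′
    H′-large = connected⇒edges H′ (spanner-connected {k = k} connected stretch)

corollary1p13 : Σ ℕ (λ c → Σ ℕ (λ β → Σ ℕ (λ N →
                  ∀ (n k : ℕ) → N ≤ n → 4 * n + 7 * c < 7 * k →
                  ApproxGood 2 β n k)))
corollary1p13 = 0 , 3 , 1 , λ n k 1≤n k-large →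
  approxGood n k 1≤n (subst (_< 7 * k) (+-identityʳ (4 * n)) k-large)
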